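{- Let $X=\{a_1,\dots,a_n\}$, let $\mathcal{F}$ be a union-closed family of subsets of $X$ with $\bigcup_{f\in\mathcal{F}}f=X$, let $w=a_1\cdots a_n$, $\mathcal{U}=\varphi_w(\mathcal{F})$, and let $a\in X$. Then the map $\psi(z)=z\cup\{a\}$ is an injection from $\mathcal{U}_{\bar a}=\{\eta\in\mathcal{U}:a\notin\eta\}$ into $\varphi_w(\mathcal{F}_a)$, where $\mathcal{F}_a=\{f\in\mathcal{F}:a\in f\}$.
   Context: Union-closed: $f,g\in\mathcal{F}\Rightarrow f\cup g\in\mathcal{F}$. Rising functions: for $T\subseteq 2^X$ and $b\in X$, $\varphi_{T,b}(z)=z\cup\{b\}$ if $z\cup\{b\}\notin T$, and $\varphi_{T,b}(z)=z$ otherwise. With $\varphi_0=\mathrm{id}$, $\mathcal{F}_0=\mathcal{F}$, $\varphi_j=\varphi_{\mathcal{F}_{j-1},a_j}\circ\varphi_{j-1}$, $\mathcal{F}_j=\varphi_j(\mathcal{F})$ for $1\le j\le n$, set $\varphi_w=\varphi_n$. -}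

module Defs where

open import Data.Bool using (Bool; if_then_else_)
import Data.Bool.Properties as BoolP
open import Data.Fin using (Fin)
open import Data.Fin.Subset public using (Subset; _∪_; ⁅_⁆; _∈_; _∉_; ⋃)
open import Data.Vec.Properties using (≡-dec)
open import Data.List using (List; []; _∷_; map; allFin; filter)
import Data.List.Membership.DecPropositional as LDM
import Data.Fin.Subset.Properties as SP
open import Relation.Binary.PropositionalEquality using (_≡_)
open import Relation.Nullary using (Dec)
import Data.List.Membership.Propositional as LM
open import Data.Product using (Σ; _×_)
open import Relation.Nullary.Decidable using (does; ⌊_⌋)
open import Function using (id; _∘_)

-- X = {a_1,…,a_n} is modelled by Fin n, with a_j = the (j-1)-th element
-- (so the word w = a_1 ⋯ a_n is allFin n in increasing order).
-- A family of subsets of X is a finite list of subsets (duplicates irrelevant);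
-- membership of a subset in a family is list membership.

Family : ∀ n → Set
Family n = List (Subset n)

_∈F_ : ∀ {n} → Subset n → Family n → Set
z ∈F 𝓕 = z LM.∈ 𝓕

UnionClosed : ∀ {n} → Family n → Set
UnionClosed 𝓕 = ∀ f g → f ∈F 𝓕 → g ∈F 𝓕 → (f ∪ g) ∈F 𝓕

CoversX : ∀ {n} → Family n → Set
CoversX {n} 𝓕 = ∀ (x : Fin n) → Σ (Subset n) λ f → f ∈F 𝓕 × x ∈ f

image : ∀ {n} → (Subset n → Subset n) → Family n → Family n
image = map

rise : ∀ {n} → Family n → Fin n → Subset n → Subset n
rise {n} T b z = if does (LDM._∈?_ (≡-dec {n = n} BoolP._≟_) (z ∪ ⁅ b ⁆) T) then z else (z ∪ ⁅ b ⁆)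

-- Processing the letters of a word: given the current φ_{j-1},
-- 𝓕_{j-1} = φ_{j-1}(𝓕) and φ_j = φ_{𝓕_{j-1}, a_j} ∘ φ_{j-1}.
risingWord : ∀ {n} → Family n → (Subset n → Subset n) → List (Fin n) → (Subset n → Subset n)
risingWord 𝓕 φ [] = φ
risingWord 𝓕 φ (b ∷ bs) = risingWord 𝓕 (rise (image φ 𝓕) b ∘ φ) bs

φw : ∀ {n} → Family n → Subset n → Subset n
φw {n} 𝓕 = risingWord 𝓕 id (allFin n)

withElem : ∀ {n} → Fin n → Family n → Family n
withElem a 𝓕 = filter (λ f → a SP.∈? f) 𝓕

-- Injectivity is plain set algebra: z ↦ z ∪ {a} is injective on sets
-- avoiding a.  For the mapping property we follow the rising functions
-- φ₀ = id, φ₁, …, φₙ = φ_w letter by letter and maintain an invariant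
-- (record Invariant) that mentions the set Done of letters processed so far:
--   * φ is extensive on 𝓕:            f ⊆ φ f;
--   * φ reflects inclusion on 𝓕:      g ⊆ φ f ⇒ g ⊆ f;
--   * joins stay in the image:         φ f ∪ h ∈ φ(𝓕) whenever h ⊈ f and
--                                      the Done-letters of h lie in φ f;
--   * the image is upward closed in the Done letters: η ∈ φ(𝓕) ⇒ η ∪ {c} ∈ φ(𝓕).
-- The identity satisfies it with Done = ∅ (the join clause is union-closedness),
-- one rising step with a fresh letter b extends it to Done ∪ {b}, and since
-- the letters of w are distinct, φ_w satisfies it with Done = X.  The
-- theorem then follows: if φ g ∪ {a} = φ f with a ∉ f, extensivity and
-- reflection force f = g, so a ∈ φ g.

module Submission where

open import Defs
open import Data.Nat using (ℕ)
open import Data.Fin using (Fin)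
open import Data.Fin.Subset using (_⊆_)
import Data.Fin.Subset.Properties as SP
open import Data.Product using (_×_; _,_)
open import Data.Sum using (_⊎_; inj₁; inj₂; [_,_])
open import Data.Unit using (⊤; tt)
open import Data.Empty using (⊥; ⊥-elim)
open import Function using (_∘_)
open import Relation.Binary.PropositionalEquality
  using (_≡_; refl; sym; trans; cong; subst)
open import Relation.Nullary using (¬_; yes; no)
import Data.Bool.Properties as BoolP
open import Data.Vec.Properties using (≡-dec)
open import Data.List using (_∷_; []; allFin)
open import Data.List.Properties using (map-∘)
import Data.List.Membership.DecPropositional as LDM
import Data.List.Membership.Propositional as LM
open import Data.List.Membership.Propositional.Properties
  using (∈-map⁺; ∈-map⁻; ∈-filter⁺; ∈-allFin)
open import Data.List.Relation.Unary.Any using (here; there)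
import Data.List.Relation.Unary.All as All
open import Data.List.Relation.Unary.AllPairs using (_∷_)
open import Data.List.Relation.Unary.Unique.Propositional using (Unique)
open import Data.List.Relation.Unary.Unique.Propositional.Properties
  using (allFin⁺)

module SubsetFacts {n : ℕ} where

  ∈-∪⁅⁆⁻ : ∀ {x} (p : Subset n) (b : Fin n) → x ∈ p ∪ ⁅ b ⁆ → x ∈ p ⊎ x ≡ b
  ∈-∪⁅⁆⁻ p b x∈ = Data.Sum.map₂ (SP.x∈⁅y⁆⇒x≡y b) (SP.x∈p∪q⁻ p ⁅ b ⁆ x∈)

  ∪⁅⁆-strip : ∀ (P : Fin n → Set) {p b x} → ¬ P b → P x → x ∈ p ∪ ⁅ b ⁆ → x ∈ p
  ∪⁅⁆-strip P {p} {b} ¬Pb Px x∈ with ∈-∪⁅⁆⁻ p b x∈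
  ... | inj₁ x∈p = x∈p
  ... | inj₂ refl = ⊥-elim (¬Pb Px)

  ⊆-∪⁅⁆-strip : ∀ {p q : Subset n} {b} → b ∉ q → q ⊆ p ∪ ⁅ b ⁆ → q ⊆ p
  ⊆-∪⁅⁆-strip {q = q} b∉q q⊆ x∈q = ∪⁅⁆-strip (_∈ q) b∉q x∈q (q⊆ x∈q)

  ∪-least : ∀ {p q r : Subset n} → p ⊆ r → q ⊆ r → p ∪ q ⊆ r
  ∪-least {p} {q} p⊆r q⊆r x∈ = [ p⊆r , q⊆r ] (SP.x∈p∪q⁻ p q x∈)

  ∪⁅⁆-absorb : ∀ (p : Subset n) {b} → b ∈ p → p ∪ ⁅ b ⁆ ≡ p
  ∪⁅⁆-absorb p {b} b∈p =
    SP.⊆-antisym (∪-least (λ x∈ → x∈) (λ x∈ → subst (_∈ p) (sym (SP.x∈⁅y⁆⇒x≡y b x∈)) b∈p))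
                 (SP.p⊆p∪q ⁅ b ⁆)

  ∪⁅⁆-idem : ∀ (p : Subset n) b → (p ∪ ⁅ b ⁆) ∪ ⁅ b ⁆ ≡ p ∪ ⁅ b ⁆
  ∪⁅⁆-idem p b = ∪⁅⁆-absorb (p ∪ ⁅ b ⁆) (SP.q⊆p∪q p ⁅ b ⁆ (SP.x∈⁅x⁆ b))

  ∪-as-∪⁅⁆ : ∀ {p q : Subset n} {b} → b ∈ q → q ⊆ p ∪ ⁅ b ⁆ → p ∪ q ≡ p ∪ ⁅ b ⁆
  ∪-as-∪⁅⁆ {p} {q} {b} b∈q q⊆ =
    SP.⊆-antisym (∪-least (SP.p⊆p∪q ⁅ b ⁆) q⊆)
                 (∪-least (SP.p⊆p∪q q)
                          (λ x∈ → SP.q⊆p∪q p q (subst (_∈ q) (sym (SP.x∈⁅y⁆⇒x≡y b x∈)) b∈q)))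

  ∪-swapʳ : ∀ (p q r : Subset n) → (p ∪ q) ∪ r ≡ (p ∪ r) ∪ q
  ∪-swapʳ p q r =
    trans (SP.∪-assoc p q r) (trans (cong (p ∪_) (SP.∪-comm q r)) (sym (SP.∪-assoc p r q)))

  ∪⁅⁆-cancel : ∀ {p q : Subset n} {a} → a ∉ p → a ∉ q → p ∪ ⁅ a ⁆ ≡ q ∪ ⁅ a ⁆ → p ≡ q
  ∪⁅⁆-cancel {a = a} a∉p a∉q eq = SP.⊆-antisym (below a∉p eq) (below a∉q (sym eq))
    where
      below : ∀ {u v} → a ∉ u → u ∪ ⁅ a ⁆ ≡ v ∪ ⁅ a ⁆ → u ⊆ v
      below {u} a∉u e = ⊆-∪⁅⁆-strip a∉u (λ x∈u → subst (_ ∈_) e (SP.p⊆p∪q ⁅ a ⁆ x∈u))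

open SubsetFacts

module RisingFacts {n : ℕ} where

  data RiseView (T : Family n) (b : Fin n) (x : Subset n) : Subset n → Set where
    kept  : (x ∪ ⁅ b ⁆) ∈F T → RiseView T b x x
    moved : ¬ (x ∪ ⁅ b ⁆) ∈F T → RiseView T b x (x ∪ ⁅ b ⁆)

  riseView : ∀ T b x → RiseView T b x (rise T b x)
  riseView T b x with LDM._∈?_ (≡-dec {n = n} BoolP._≟_) (x ∪ ⁅ b ⁆) T
  ... | yes p = kept p
  ... | no ¬p = moved ¬p

  rise-keeps : ∀ {T b y} → y ∈F T → (y ∪ ⁅ b ⁆) ∈F T → y ∈F image (rise T b) T
  rise-keeps {T} {b} {y} y∈T yb∈T with rise T b y | riseView T b y | ∈-map⁺ (rise T b) y∈T
  ... | _ | kept _   | m = m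
  ... | _ | moved ¬p | _ = ⊥-elim (¬p yb∈T)

  rise-adds : ∀ {T b y} → y ∈F T → (y ∪ ⁅ b ⁆) ∈F image (rise T b) T
  rise-adds {T} {b} {y} y∈T with rise T b y | riseView T b y | ∈-map⁺ (rise T b) y∈T
  ... | _ | moved _  | m = m
  ... | _ | kept yb∈T | _ = rise-keeps yb∈T (subst (_∈F T) (sym (∪⁅⁆-idem y b)) yb∈T)

open RisingFacts

module Rising {n : ℕ} (𝓕 : Family n) (closed : UnionClosed 𝓕) where

  _∈Im_ : Subset n → (Subset n → Subset n) → Set
  z ∈Im φ = z ∈F image φ 𝓕

  next : (Subset n → Subset n) → Fin n → Subset n → Subset n
  next φ b = rise (image φ 𝓕) b ∘ φ

  from-risen : ∀ {φ b z} → z ∈F image (rise (image φ 𝓕) b) (image φ 𝓕) → z ∈Im next φ b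
  from-risen {φ} {z = z} = subst (z LM.∈_) (sym (map-∘ 𝓕))

  record Invariant (Done : Fin n → Set) (φ : Subset n → Subset n) : Set where
    field
      extensive : ∀ {f} → f ∈F 𝓕 → f ⊆ φ f
      reflect   : ∀ {f g} → f ∈F 𝓕 → g ∈F 𝓕 → g ⊆ φ f → g ⊆ f
      joins     : ∀ {f h} → f ∈F 𝓕 → h ∈F 𝓕 → (∀ {c} → Done c → c ∈ h → c ∈ φ f) →
                  ¬ h ⊆ f → (φ f ∪ h) ∈Im φ
      upward    : ∀ {c z} → Done c → z ∈Im φ → (z ∪ ⁅ c ⁆) ∈Im φ
  open Invariant

  -- Before any letter is processed, the join clause is union-closedness.
  identity-invariant : Invariant (λ _ → ⊥) (λ z → z)
  identity-invariant .extensive _ x∈ = x∈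
  identity-invariant .reflect _ _ g⊆ = g⊆
  identity-invariant .joins {f} {h} f∈ h∈ _ _ = ∈-map⁺ (λ z → z) (closed f h f∈ h∈)
  identity-invariant .upward ()

  invariant-cong : ∀ {P Q φ} → (∀ {c} → P c → Q c) → (∀ {c} → Q c → P c) →
                   Invariant P φ → Invariant Q φ
  invariant-cong _ _ I .extensive = I .extensive
  invariant-cong _ _ I .reflect = I .reflect
  invariant-cong P→Q _ I .joins f∈ h∈ H h⊈f = I .joins f∈ h∈ (H ∘ P→Q) h⊈f
  invariant-cong _ Q→P I .upward Qc = I .upward (Q→P Qc)

  module Step {Done : Fin n → Set} {φ : Subset n → Subset n}
              (I : Invariant Done φ) (b : Fin n) (¬Done-b : ¬ Done b) where

    ψ : Subset n → Subset n
    ψ = next φ b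

    Done′ : Fin n → Set
    Done′ c = c ≡ b ⊎ Done c

    view : ∀ f → RiseView (image φ 𝓕) b (φ f) (ψ f)
    view f = riseView (image φ 𝓕) b (φ f)

    keeps : ∀ {y} → y ∈Im φ → (y ∪ ⁅ b ⁆) ∈Im φ → y ∈Im ψ
    keeps y∈ yb∈ = from-risen {φ} (rise-keeps y∈ yb∈)

    adds : ∀ {y} → y ∈Im φ → (y ∪ ⁅ b ⁆) ∈Im ψ
    adds y∈ = from-risen {φ} (rise-adds y∈)

    image-φ : ∀ {f} → f ∈F 𝓕 → φ f ∈Im φ
    image-φ = ∈-map⁺ φ

    strip-done : ∀ {p c} → Done c → c ∈ p ∪ ⁅ b ⁆ → c ∈ p
    strip-done = ∪⁅⁆-strip Done ¬Done-b

    -- A rising step only ever adds b, so extensivity persists.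
    extensive′ : ∀ {f} → f ∈F 𝓕 → f ⊆ ψ f
    extensive′ {f} f∈ with ψ f | view f
    ... | _ | kept _  = I .extensive f∈
    ... | _ | moved _ = SP.⊆-trans (I .extensive f∈) (SP.p⊆p∪q ⁅ b ⁆)

    -- If f was moved to φ f ∪ {b}, a member g ∋ b below it but not below f
    -- would make φ f ∪ g = φ f ∪ {b} a join in φ(𝓕), i.e. f would have stayed.
    reflect′ : ∀ {f g} → f ∈F 𝓕 → g ∈F 𝓕 → g ⊆ ψ f → g ⊆ f
    reflect′ {f} {g} f∈ g∈ g⊆ with ψ f | view f
    ... | _ | kept _ = I .reflect f∈ g∈ g⊆
    ... | _ | moved ¬fb∈ with b SP.∈? g | g SP.⊆? f
    ...   | no b∉g | _      = I .reflect f∈ g∈ (⊆-∪⁅⁆-strip b∉g g⊆)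
    ...   | yes _  | yes g⊆f = g⊆f
    ...   | yes b∈g | no g⊈f =
      ⊥-elim (¬fb∈ (subst (_∈Im φ) (∪-as-∪⁅⁆ b∈g g⊆)
                          (I .joins f∈ g∈ (λ Dc c∈g → strip-done Dc (g⊆ c∈g)) g⊈f)))

    -- The join clause in the case where f was kept: adding b to the join
    -- φ f ∪ h stays in φ(𝓕), either because b is already there or via the
    -- join of h with the member f′ for which φ f′ = φ f ∪ {b}.
    kept-join : ∀ {f h} → f ∈F 𝓕 → h ∈F 𝓕 → (φ f ∪ ⁅ b ⁆) ∈Im φ →
                (∀ {c} → Done′ c → c ∈ h → c ∈ φ f) → ¬ h ⊆ f → ((φ f ∪ h) ∪ ⁅ b ⁆) ∈Im φ
    kept-join {f} {h} f∈ h∈ fb∈ H h⊈f with b SP.∈? h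
    ... | yes b∈h =
      subst (_∈Im φ) (sym (∪⁅⁆-absorb (φ f ∪ h) (SP.p⊆p∪q h (H (inj₁ refl) b∈h))))
            (I .joins f∈ h∈ (H ∘ inj₂) h⊈f)
    ... | no b∉h with ∈-map⁻ φ fb∈
    ...   | f′ , f′∈ , fb≡f′ =
      subst (_∈Im φ) (trans (cong (_∪ h) (sym fb≡f′)) (∪-swapʳ (φ f) ⁅ b ⁆ h))
            (I .joins f′∈ h∈ below-f′ h⊈f′)
      where
        below-f′ : ∀ {c} → Done c → c ∈ h → c ∈ φ f′
        below-f′ Dc c∈h = subst (_ ∈_) fb≡f′ (SP.p⊆p∪q ⁅ b ⁆ (H (inj₂ Dc) c∈h))
        h⊈f′ : ¬ h ⊆ f′
        h⊈f′ h⊆f′ = h⊈f (I .reflect f∈ h∈ (⊆-∪⁅⁆-strip b∉h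
                      (λ x∈h → subst (_ ∈_) (sym fb≡f′) (I .extensive f′∈ (h⊆f′ x∈h)))))

    -- A kept f keeps its join (kept-join supplies the b-enlarged join);
    -- for a moved f, adding b to the old join gives the new one.
    joins′ : ∀ {f h} → f ∈F 𝓕 → h ∈F 𝓕 → (∀ {c} → Done′ c → c ∈ h → c ∈ ψ f) →
             ¬ h ⊆ f → (ψ f ∪ h) ∈Im ψ
    joins′ {f} {h} f∈ h∈ H h⊈f with ψ f | view f
    ... | _ | kept fb∈ =
      keeps (I .joins f∈ h∈ (H ∘ inj₂) h⊈f) (kept-join f∈ h∈ fb∈ H h⊈f)
    ... | _ | moved _ =
      subst (_∈Im ψ) (∪-swapʳ (φ f) h ⁅ b ⁆)
            (adds (I .joins f∈ h∈ (λ Dc c∈h → strip-done Dc (H (inj₂ Dc) c∈h)) h⊈f))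

    -- Upward closure in b holds by rise-adds; upward closure in an older
    -- letter c commutes with the rising step, since adding c and b commute.
    upward′ : ∀ {c z} → Done′ c → z ∈Im ψ → (z ∪ ⁅ c ⁆) ∈Im ψ
    upward′ {c} Dc z∈ with ∈-map⁻ ψ z∈
    ... | f , f∈ , refl with ψ f | view f | Dc
    ... | _ | kept _    | inj₁ refl = adds (image-φ f∈)
    ... | _ | moved _   | inj₁ refl =
      subst (_∈Im ψ) (sym (∪⁅⁆-idem (φ f) b)) (adds (image-φ f∈))
    ... | _ | kept fb∈  | inj₂ Dc′ =
      keeps (I .upward Dc′ (image-φ f∈))
            (subst (_∈Im φ) (∪-swapʳ (φ f) ⁅ b ⁆ ⁅ c ⁆) (I .upward Dc′ fb∈))
    ... | _ | moved _   | inj₂ Dc′ =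
      subst (_∈Im ψ) (∪-swapʳ (φ f) ⁅ c ⁆ ⁅ b ⁆) (adds (I .upward Dc′ (image-φ f∈)))

    step-invariant : Invariant Done′ ψ
    step-invariant .extensive = extensive′
    step-invariant .reflect = reflect′
    step-invariant .joins = joins′
    step-invariant .upward = upward′

  word-invariant : ∀ {Done φ} bs → Invariant Done φ → Unique bs →
                   (∀ {c} → c LM.∈ bs → ¬ Done c) →
                   Invariant (λ c → Done c ⊎ c LM.∈ bs) (risingWord 𝓕 φ bs)
  word-invariant [] I _ _ = invariant-cong inj₁ [ (λ Dc → Dc) , (λ ()) ] I
  word-invariant {Done} (b ∷ bs) I (b∉bs ∷ distinct) fresh =
    invariant-cong
      [ [ (λ { refl → inj₂ (here refl) }) , inj₁ ] , inj₂ ∘ there ]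
      [ inj₁ ∘ inj₂ , (λ { (here refl) → inj₁ (inj₁ refl) ; (there c∈) → inj₂ c∈ }) ]
      (word-invariant bs (Step.step-invariant I b (fresh (here refl))) distinct fresh′)
    where
      fresh′ : ∀ {c} → c LM.∈ bs → ¬ (c ≡ b ⊎ Done c)
      fresh′ c∈ (inj₁ refl) = All.lookup b∉bs c∈ refl
      fresh′ c∈ (inj₂ Dc) = fresh (there c∈) Dc

  φw-invariant : Invariant (λ _ → ⊤) (φw 𝓕)
  φw-invariant =
    invariant-cong (λ _ → tt) (λ _ → inj₂ (∈-allFin _))
      (word-invariant (allFin n) identity-invariant (allFin⁺ n) (λ _ ()))

  -- If a is processed and a ∉ z ∈ φ(𝓕), then z ∪ {a} = φ f for some f ∋ a:
  -- otherwise z = φ g and extensivity/reflection force f = g, so a ∈ z.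
  add-in-image-of-withElem : ∀ {Done φ a z} → Invariant Done φ → Done a →
    z ∈Im φ → a ∉ z → (z ∪ ⁅ a ⁆) ∈F image φ (withElem a 𝓕)
  add-in-image-of-withElem {φ = φ} {a} I Da z∈ a∉z with ∈-map⁻ φ z∈
  ... | g , g∈ , refl with ∈-map⁻ φ (I .upward Da z∈)
  ...   | f , f∈ , ga≡f with a SP.∈? f
  ...     | yes a∈f =
    subst (_∈F image φ (withElem a 𝓕)) (sym ga≡f) (∈-map⁺ φ (∈-filter⁺ (a SP.∈?_) f∈ a∈f))
  ...     | no a∉f = ⊥-elim (a∉z (subst (a ∈_) (cong φ f≡g) a∈φf))
    where
      f⊆g : f ⊆ g
      f⊆g = I .reflect g∈ f∈
              (⊆-∪⁅⁆-strip a∉f (λ x∈f → subst (_ ∈_) (sym ga≡f) (I .extensive f∈ x∈f)))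
      g⊆f : g ⊆ f
      g⊆f = I .reflect f∈ g∈
              (λ x∈g → subst (_ ∈_) ga≡f (SP.p⊆p∪q ⁅ a ⁆ (I .extensive g∈ x∈g)))
      f≡g : f ≡ g
      f≡g = SP.⊆-antisym f⊆g g⊆f
      a∈φf : a ∈ φ f
      a∈φf = subst (a ∈_) ga≡f (SP.q⊆p∪q (φ g) ⁅ a ⁆ (SP.x∈⁅x⁆ a))

lemma3p6 : ∀ (n : ℕ) (𝓕 : Family n) → UnionClosed 𝓕 → CoversX 𝓕 → (a : Fin n) →
    ((∀ z → z ∈F image (φw 𝓕) 𝓕 → a ∉ z → (z ∪ ⁅ a ⁆) ∈F image (φw 𝓕) (withElem a 𝓕))
    × (∀ z z′ → z ∈F image (φw 𝓕) 𝓕 → a ∉ z → z′ ∈F image (φw 𝓕) 𝓕 → a ∉ z′ →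
         z ∪ ⁅ a ⁆ ≡ z′ ∪ ⁅ a ⁆ → z ≡ z′))
lemma3p6 n 𝓕 closed _ a =
  (λ _ z∈ a∉z → add-in-image-of-withElem φw-invariant tt z∈ a∉z) ,
  (λ _ _ _ a∉z _ a∉z′ → ∪⁅⁆-cancel a∉z a∉z′)
  where open Rising 𝓕 closed
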